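{- Let $\epsilon\in(0,1)$ and $\theta\in[\mathrm{OPT}/\epsilon,2\mathrm{OPT}/\epsilon]$. For any $S\subseteq[n]$ and any $v\ge\theta$, $F(S,v)\ge W(S,v)\ge(1-\epsilon)\cdot F(S,v)$, where $W(S,v)=\mathbb{E}[(\max_{i\in S}\kappa_i-v)_+]$ and $F(S,v)=\sum_{i\in S}\mathbb{E}[(\kappa_i-v)_+]$.
   Context: An instance of PNOI consists of $n$ boxes; box $i$ has cost $c_i\ge0$ and hidden value $v_i\ge0$ drawn independently from a known finitely supported distribution $F_i$. A policy at each step may open an unopened box $i$ (paying $c_i$, observing $v_i$), or stop and take the opened box with the highest revealed value, or stop and take an unopened box without inspection; payoff = value taken minus total cost; $\mathrm{OPT}$ is the maximum expected payoff. The index $\tau_i$ solves $\mathbb{E}[(v_i-\tau_i)_+]=c_i$, and $\kappa_i=\min\{v_i,\tau_i\}$; $(x)_+=\max\{0,x\}$, and the maximum over the empty set is taken so that $W(\emptyset,v)=0$.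
   Formalization: The values and probabilities of each $F_i$, the costs $c_i$, the indices $\tau_i$ and the parameters $\epsilon$, $\theta$ and $v$ are all rational. -}

module Defs where

open import Data.Nat using (ℕ; zero; suc)
open import Data.Bool using (Bool; true; false; if_then_else_)
open import Data.Fin using (Fin)
open import Data.Product using (_×_; _,_; proj₁; proj₂)
open import Data.List using (List; []; _∷_; foldr; map; concatMap; allFin)
open import Data.Vec using (Vec; []; _∷_; lookup; _[_]≔_; tabulate)
open import Data.Fin.Subset using (Subset; inside; outside; ⊤)
open import Data.Rational using (ℚ; 0ℚ; _+_; _*_; _-_; _⊔_; _⊓_)

-- A finitely supported distribution: list of (value , probability) atoms.
Dist : Set
Dist = List (ℚ × ℚ)

expect : Dist → (ℚ → ℚ) → ℚ
expect []            g = 0ℚ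
expect ((x , p) ∷ d) g = p * g x + expect d g

pos : ℚ → ℚ
pos x = 0ℚ ⊔ x

-- Distribution of κ = min{v, τ} when v ~ d.
kappaDist : Dist → ℚ → Dist
kappaDist d τ = map (λ a → (proj₁ a ⊓ τ , proj₂ a)) d

-- E[ g (m ⊔ max_{i ∈ S} X_i) ] for independent X_i ~ ds_i
-- (max over the empty set is taken to be the starting value m).
expMax : ∀ {n} → Vec Dist n → Subset n → (ℚ → ℚ) → ℚ → ℚ
expMax []       []            g m = g m
expMax (d ∷ ds) (false ∷ S)   g m = expMax ds S g m
expMax (d ∷ ds) (true  ∷ S)   g m = expect d (λ x → expMax ds S g (m ⊔ x))

sumOver : ∀ {n} → Vec Dist n → Subset n → (ℚ → ℚ) → ℚ
sumOver []       []          g = 0ℚ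
sumOver (d ∷ ds) (false ∷ S) g = sumOver ds S g
sumOver (d ∷ ds) (true  ∷ S) g = expect d g + sumOver ds S g

kappaDists : ∀ {n} → (Fin n → Dist) → (Fin n → ℚ) → Vec Dist n
kappaDists D τ = tabulate (λ i → kappaDist (D i) (τ i))

-- W(S,v) = E[(max_{i∈S} κ_i - v)_+], with max over ∅ equal to 0 (values are ≥ 0).
W : ∀ {n} → (Fin n → Dist) → (Fin n → ℚ) → Subset n → ℚ → ℚ
W D τ S v = expMax (kappaDists D τ) S (λ y → pos (y - v)) 0ℚ

F : ∀ {n} → (Fin n → Dist) → (Fin n → ℚ) → Subset n → ℚ → ℚ
F D τ S v = sumOver (kappaDists D τ) S (λ y → pos (y - v))

-- Bellman value of the PNOI game. U = set of unopened boxes, m = best value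
-- revealed so far (0 if nothing opened, which is also the payoff of stopping
-- with nothing). Options: stop and take best opened box (m); for i ∈ U, take
-- box i uninspected (E[v_i]); or open box i (pay c_i, continue).
-- The fuel k decreases with each opening; fuel n suffices.
value : ∀ {n} → (Fin n → ℚ) → (Fin n → Dist) → ℕ → Subset n → ℚ → ℚ
value {n} c D zero    U m = m
value {n} c D (suc k) U m =
  foldr _⊔_ m (concatMap options (allFin n))
  where
  options : Fin n → List ℚ
  options i = if lookup U i
    then (expect (D i) (λ x → x)
          ∷ (expect (D i) (λ x → value c D k (U [ i ]≔ outside) (m ⊔ x)) - c i)
          ∷ [])
    else []

-- OPT = maximum expected payoff over all (adaptive) policies.
OPT : ∀ {n} → (Fin n → ℚ) → (Fin n → Dist) → ℚ
OPT {n} c D = value c D n ⊤ 0ℚ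

{-# OPTIONS --safe #-}
-- Let g(y) = (y - v)₊, which vanishes below v. Since g(max_i κ_i) ≤ Σ_i g(κ_i), W ≤ F.
-- Conversely, restricting to the event that no other κ_j reaches v gives
-- W ≥ Σ_{i∈S} E[g(κ_i)] ∏_{j≠i} Pr[κ_j < v] ≥ Π·F with Π = ∏_{i∈S} Pr[κ_i < v],
-- so it suffices to show 1 - Π ≤ ε. Consider the policy that opens the boxes i ∈ S with τ_i ≥ v
-- one by one and stops as soon as it has seen a value ≥ v. As c_i = E[(v_i - τ_i)₊], paying c_i
-- amounts to giving up the excess of v_i over τ_i, so when it stops on seeing some v_i ≥ v it
-- nets at least min(v_i, τ_i) ≥ v; hence v(1 - Π) ≤ OPT ≤ εθ ≤ εv. When v = 0 this says
-- nothing, but then OPT = 0, and the single-box policies "open i, keep max(v_i, 0)" give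
-- F ≤ OPT = 0.
module Submission where

open import Defs
open import Data.Bool using (Bool; true; false; if_then_else_)
open import Data.Fin using (Fin; zero; suc)
open import Data.Fin.Subset using (Subset; outside; ⊤)
open import Data.Fin.Subset.Properties using (∈⊤)
open import Data.List as List using (List; []; _∷_; allFin; length)
open import Data.List.Properties using (foldr-preservesᵒ; length-tabulate)
open import Data.List.Membership.Propositional.Properties using (∈-allFin)
open import Data.List.Relation.Unary.All as All using (All; []; _∷_)
import Data.List.Relation.Unary.All.Properties as All
open import Data.List.Relation.Unary.AllPairs using ([]; _∷_)
open import Data.List.Relation.Unary.Any as Any using (Any; here; there)
open import Data.List.Relation.Unary.Any.Properties using (concatMap⁺)
open import Data.List.Relation.Unary.Unique.Propositional using (Unique)
open import Data.List.Relation.Unary.Unique.Propositional.Properties using (allFin⁺)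
open import Data.Nat as ℕ using (ℕ; s≤s)
import Data.Nat.Properties as ℕ
open import Data.Product using (_×_; _,_; proj₁; proj₂)
open import Data.Rational
  using (ℚ; 0ℚ; 1ℚ; _+_; _*_; _-_; -_; _≤_; _<_; _⊔_; _⊓_; _≤?_; _<?_; positive; nonNegative)
open import Data.Rational.Properties
open import Data.Rational.Solver using (module +-*-Solver)
open import Data.Sum using (_⊎_; inj₁; inj₂; [_,_])
open import Data.Vec using (Vec; []; _∷_; lookup; tabulate; _[_]≔_)
open import Data.Vec.Properties using ([]=⇒lookup; lookup∘update′)
open import Data.Vec.Relation.Unary.All as Vec using ([]; _∷_)
import Data.Vec.Relation.Unary.All.Properties as Vec
open import Function using (_∘_; id)
open import Relation.Binary.Definitions using (Monotonic₁)
open import Relation.Binary.PropositionalEquality hiding ([_])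
open import Relation.Nullary using (¬_; yes; no; does; contradiction)
open import Relation.Nullary.Decidable using (dec-true; dec-false)

open +-*-Solver

<⇒≱ : ∀ {p q} → p < q → ¬ q ≤ p
<⇒≱ p<q q≤p = <-irrefl refl (<-≤-trans p<q q≤p)

⊔-lub-< : ∀ {p q r} → p < r → q < r → p ⊔ q < r
⊔-lub-< {p} {q} p<r q<r with ⊔-sel p q
... | inj₁ p⊔q≡p = subst (_< _) (sym p⊔q≡p) p<r
... | inj₂ p⊔q≡q = subst (_< _) (sym p⊔q≡q) q<r

0≤1 : 0ℚ ≤ 1ℚ
0≤1 = <⇒≤ (positive⁻¹ 1ℚ)

p≤q⇒0≤q-p : ∀ {p q} → p ≤ q → 0ℚ ≤ q - p
p≤q⇒0≤q-p {p} {q} p≤q = subst (_≤ q - p) (+-inverseʳ p) (+-monoˡ-≤ (- p) p≤q)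

0≤q-p⇒p≤q : ∀ {p q} → 0ℚ ≤ q - p → p ≤ q
0≤q-p⇒p≤q {p} {q} 0≤q-p =
  subst₂ _≤_ (+-identityˡ p) (solve 2 (λ p q → (q :- p) :+ p := q) refl p q) (+-monoˡ-≤ p 0≤q-p)

p-q≤p : ∀ p {q} → 0ℚ ≤ q → p - q ≤ p
p-q≤p p 0≤q = subst (p - _ ≤_) (+-identityʳ p) (+-monoʳ-≤ p (neg-antimono-≤ 0≤q))

p-q≤r⇒p-r≤q : ∀ {p q r} → p - q ≤ r → p - r ≤ q
p-q≤r⇒p-r≤q {p} {q} {r} p-q≤r =
  0≤q-p⇒p≤q (subst (0ℚ ≤_) (solve 3 (λ p q r → r :- (p :- q) := q :- (p :- r)) refl p q r)
                    (p≤q⇒0≤q-p p-q≤r))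

*-monoˡ-≤-0≤ : ∀ {r p q} → 0ℚ ≤ r → p ≤ q → r * p ≤ r * q
*-monoˡ-≤-0≤ {r} 0≤r = *-monoˡ-≤-nonNeg r {{nonNegative 0≤r}}

*-monoʳ-≤-0≤ : ∀ {r p q} → 0ℚ ≤ r → p ≤ q → p * r ≤ q * r
*-monoʳ-≤-0≤ {r} 0≤r = *-monoʳ-≤-nonNeg r {{nonNegative 0≤r}}

0≤p⇒0≤q⇒0≤p*q : ∀ {p q} → 0ℚ ≤ p → 0ℚ ≤ q → 0ℚ ≤ p * q
0≤p⇒0≤q⇒0≤p*q {p} {q} 0≤p 0≤q = subst (_≤ p * q) (*-zeroʳ p) (*-monoˡ-≤-0≤ 0≤p 0≤q)

pos-nonNeg : ∀ p → 0ℚ ≤ pos p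
pos-nonNeg p = p≤p⊔q 0ℚ p

pos-mono-≤ : Monotonic₁ _≤_ _≤_ pos
pos-mono-≤ = ⊔-monoʳ-≤ 0ℚ

0≤p⇒pos[p]≡p : ∀ {p} → 0ℚ ≤ p → pos p ≡ p
0≤p⇒pos[p]≡p = p≤q⇒p⊔q≡q

p≤q⇒pos[p-q]≡0 : ∀ {p q} → p ≤ q → pos (p - q) ≡ 0ℚ
p≤q⇒pos[p-q]≡0 {p} {q} p≤q = p≥q⇒p⊔q≡p (subst (p - q ≤_) (+-inverseʳ q) (+-monoˡ-≤ (- q) p≤q))

p-pos[p-q]≡p⊓q : ∀ p q → p - pos (p - q) ≡ p ⊓ q
p-pos[p-q]≡p⊓q p q with ≤-total p q
... | inj₁ p≤q rewrite p≤q⇒pos[p-q]≡0 p≤q | p≤q⇒p⊓q≡p p≤q =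
  solve 1 (λ p → p :- con 0ℚ := p) refl p
... | inj₂ q≤p rewrite 0≤p⇒pos[p]≡p (p≤q⇒0≤q-p q≤p) | p≥q⇒p⊓q≡q q≤p =
  solve 2 (λ p q → p :- (p :- q) := q) refl p q

pos[p]-pos[p-q]≡pos[p⊓q] : ∀ p {q} → 0ℚ ≤ q → pos p - pos (p - q) ≡ pos (p ⊓ q)
pos[p]-pos[p-q]≡pos[p⊓q] p {q} 0≤q with ≤-total p q
... | inj₁ p≤q rewrite p≤q⇒pos[p-q]≡0 p≤q | p≤q⇒p⊓q≡p p≤q =
  solve 1 (λ p → p :- con 0ℚ := p) refl (pos p)
... | inj₂ q≤p rewrite p≥q⇒p⊓q≡q q≤p | 0≤p⇒pos[p]≡p (≤-trans 0≤q q≤p) | 0≤p⇒pos[p]≡p 0≤q =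
  trans (p-pos[p-q]≡p⊓q p q) (p≥q⇒p⊓q≡q q≤p)

expect-cong : ∀ d {f g} → (∀ x → f x ≡ g x) → expect d f ≡ expect d g
expect-cong []            f≗g = refl
expect-cong ((x , p) ∷ d) f≗g = cong₂ (λ a b → p * a + b) (f≗g x) (expect-cong d f≗g)

expect-+ : ∀ d f g → expect d (λ x → f x + g x) ≡ expect d f + expect d g
expect-+ []            f g = refl
expect-+ ((x , p) ∷ d) f g rewrite expect-+ d f g =
  solve 5 (λ p a b e₁ e₂ → p :* (a :+ b) :+ (e₁ :+ e₂) := (p :* a :+ e₁) :+ (p :* b :+ e₂))
    refl p (f x) (g x) (expect d f) (expect d g)

expect-*ˡ : ∀ d k f → expect d (λ x → k * f x) ≡ k * expect d f
expect-*ˡ []            k f = sym (*-zeroʳ k)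
expect-*ˡ ((x , p) ∷ d) k f rewrite expect-*ˡ d k f =
  solve 4 (λ p k a e → p :* (k :* a) :+ k :* e := k :* (p :* a :+ e)) refl p k (f x) (expect d f)

expect-sub : ∀ d f g → expect d (λ x → f x - g x) ≡ expect d f - expect d g
expect-sub []            f g = refl
expect-sub ((x , p) ∷ d) f g rewrite expect-sub d f g =
  solve 5 (λ p a b e₁ e₂ → p :* (a :- b) :+ (e₁ :- e₂) := (p :* a :+ e₁) :- (p :* b :+ e₂))
    refl p (f x) (g x) (expect d f) (expect d g)

expect-const : ∀ d k → expect d (λ _ → k) ≡ k * expect d (λ _ → 1ℚ)
expect-const d k = trans (expect-cong d (λ _ → sym (*-identityʳ k))) (expect-*ˡ d k (λ _ → 1ℚ))

weights-nonNeg⇒expect-mono : ∀ {d f g} → All (λ a → 0ℚ ≤ proj₂ a) d →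
                             (∀ x → f x ≤ g x) → expect d f ≤ expect d g
weights-nonNeg⇒expect-mono []          f≤g = ≤-refl
weights-nonNeg⇒expect-mono (0≤p ∷ 0≤d) f≤g =
  +-mono-≤ (*-monoˡ-≤-0≤ 0≤p (f≤g _)) (weights-nonNeg⇒expect-mono 0≤d f≤g)

expect-kappaDist : ∀ d τ g → expect (kappaDist d τ) g ≡ expect d (λ x → g (x ⊓ τ))
expect-kappaDist []            τ g = refl
expect-kappaDist ((x , p) ∷ d) τ g = cong (p * g (x ⊓ τ) +_) (expect-kappaDist d τ g)

record IsDistribution (d : Dist) : Set where
  field
    weights-nonNeg : All (λ a → 0ℚ ≤ proj₂ a) d
    total-mass     : expect d (λ _ → 1ℚ) ≡ 1ℚ

module _ {d : Dist} (d-dist : IsDistribution d) where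
  open IsDistribution d-dist

  expect-const≡ : ∀ k → expect d (λ _ → k) ≡ k
  expect-const≡ k = trans (expect-const d k) (trans (cong (k *_) total-mass) (*-identityʳ k))

  expect-+ˡ : ∀ k f → expect d (λ x → k + f x) ≡ k + expect d f
  expect-+ˡ k f = trans (expect-+ d (λ _ → k) f) (cong (_+ expect d f) (expect-const≡ k))

  expect-mono : ∀ {f g} → (∀ x → f x ≤ g x) → expect d f ≤ expect d g
  expect-mono = weights-nonNeg⇒expect-mono weights-nonNeg

  expect-≥ : ∀ {f} k → (∀ x → k ≤ f x) → k ≤ expect d f
  expect-≥ {f} k k≤f = subst (_≤ expect d f) (expect-const≡ k) (expect-mono k≤f)

  expect-≤ : ∀ {f} k → (∀ x → f x ≤ k) → expect d f ≤ k
  expect-≤ {f} k f≤k = subst (expect d f ≤_) (expect-const≡ k) (expect-mono f≤k)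

kappaDist-isDistribution : ∀ {d} τ → IsDistribution d → IsDistribution (kappaDist d τ)
kappaDist-isDistribution {d} τ d-dist = record
  { weights-nonNeg = All.map⁺ weights-nonNeg
  ; total-mass     = trans (expect-kappaDist d τ (λ _ → 1ℚ)) total-mass
  }
  where open IsDistribution d-dist

module _ {n} (c : Fin n → ℚ) (D : Fin n → Dist) where

  private
    ≤-⊔-either : ∀ {z} x y → z ≤ x ⊎ z ≤ y → z ≤ x ⊔ y
    ≤-⊔-either x y = [ p≤q⇒p≤q⊔r y , p≤q⇒p≤r⊔q x ]

    second-option : ∀ {b z} a → b ≡ true → Any (z ≤_) (if b then a ∷ z ∷ [] else [])
    second-option a refl = there (here ≤-refl)

  value-≥-stop : ∀ k U m → m ≤ value c D k U m
  value-≥-stop ℕ.zero    U m = ≤-refl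
  value-≥-stop (ℕ.suc k) U m =
    foldr-preservesᵒ {P = m ≤_} ≤-⊔-either m (List.concatMap _ (allFin n)) (inj₁ ≤-refl)

  value-≥-open : ∀ k U m i → lookup U i ≡ true →
    expect (D i) (λ x → value c D k (U [ i ]≔ outside) (m ⊔ x)) - c i ≤ value c D (ℕ.suc k) U m
  value-≥-open k U m i U∋i = foldr-preservesᵒ ≤-⊔-either m _
    (inj₂ (concatMap⁺ _ (Any.map (λ { refl → second-option _ U∋i }) (∈-allFin i))))

indicator : Bool → ℚ
indicator b = if b then 1ℚ else 0ℚ

indicator-nonNeg : ∀ b → 0ℚ ≤ indicator b
indicator-nonNeg true  = 0≤1
indicator-nonNeg false = ≤-refl

indicator-≤1 : ∀ b → indicator b ≤ 1ℚ
indicator-≤1 true  = ≤-refl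
indicator-≤1 false = 0≤1

below : ℚ → ℚ → ℚ
below v y = indicator (does (y <? v))

below-< : ∀ {v y} → y < v → below v y ≡ 1ℚ
below-< {v} {y} y<v = cong indicator (dec-true (y <? v) y<v)

below-≥ : ∀ {v y} → v ≤ y → below v y ≡ 0ℚ
below-≥ {v} {y} v≤y = cong indicator (dec-false (y <? v) (λ y<v → <⇒≱ y<v v≤y))

lookup-⊤ : ∀ {n} (i : Fin n) → lookup ⊤ i ≡ true
lookup-⊤ {n} i = []=⇒lookup (∈⊤ {n} {i})

prodOver : ∀ {n} → Vec Dist n → Subset n → (ℚ → ℚ) → ℚ
prodOver []       []          h = 1ℚ
prodOver (d ∷ ds) (false ∷ S) h = prodOver ds S h
prodOver (d ∷ ds) (true  ∷ S) h = expect d h * prodOver ds S h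

module _ {h : ℚ → ℚ} (h-nonNeg : ∀ x → 0ℚ ≤ h x) where

  prodOver-nonNeg : ∀ {n} (ds : Vec Dist n) → Vec.All IsDistribution ds → ∀ S → 0ℚ ≤ prodOver ds S h
  prodOver-nonNeg []       []                 []          = 0≤1
  prodOver-nonNeg (d ∷ ds) (_ ∷ ds-dist)      (false ∷ S) = prodOver-nonNeg ds ds-dist S
  prodOver-nonNeg (d ∷ ds) (d-dist ∷ ds-dist) (true ∷ S)  =
    0≤p⇒0≤q⇒0≤p*q (expect-≥ d-dist 0ℚ h-nonNeg) (prodOver-nonNeg ds ds-dist S)

  prodOver-≤1 : (∀ x → h x ≤ 1ℚ) →
                ∀ {n} (ds : Vec Dist n) → Vec.All IsDistribution ds → ∀ S → prodOver ds S h ≤ 1ℚ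
  prodOver-≤1 h≤1 []       []                 []          = ≤-refl
  prodOver-≤1 h≤1 (d ∷ ds) (_ ∷ ds-dist)      (false ∷ S) = prodOver-≤1 h≤1 ds ds-dist S
  prodOver-≤1 h≤1 (d ∷ ds) (d-dist ∷ ds-dist) (true ∷ S)  = begin
    expect d h * prodOver ds S h  ≤⟨ *-monoʳ-≤-0≤ (prodOver-nonNeg ds ds-dist S) (expect-≤ d-dist 1ℚ h≤1) ⟩
    1ℚ * prodOver ds S h          ≡⟨ *-identityˡ _ ⟩
    prodOver ds S h               ≤⟨ prodOver-≤1 h≤1 ds ds-dist S ⟩
    1ℚ                            ∎
    where open ≤-Reasoning

module _ {g : ℚ → ℚ} where

  sumOver-nonPos : ∀ {n} (ds : Vec Dist n) → Vec.All (λ d → expect d g ≤ 0ℚ) ds →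
                   ∀ S → sumOver ds S g ≤ 0ℚ
  sumOver-nonPos []       []          []          = ≤-refl
  sumOver-nonPos (d ∷ ds) (_ ∷ ds≤0)  (false ∷ S) = sumOver-nonPos ds ds≤0 S
  sumOver-nonPos (d ∷ ds) (d≤0 ∷ ds≤0) (true ∷ S) = +-mono-≤ d≤0 (sumOver-nonPos ds ds≤0 S)

  expMax-≥-start : Monotonic₁ _≤_ _≤_ g →
                   ∀ {n} (ds : Vec Dist n) → Vec.All IsDistribution ds → ∀ S m → g m ≤ expMax ds S g m
  expMax-≥-start g-mono []       []                 []          m = ≤-refl
  expMax-≥-start g-mono (d ∷ ds) (_ ∷ ds-dist)      (false ∷ S) m = expMax-≥-start g-mono ds ds-dist S m
  expMax-≥-start g-mono (d ∷ ds) (d-dist ∷ ds-dist) (true ∷ S)  m =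
    expect-≥ d-dist (g m) λ x →
      ≤-trans (g-mono (p≤p⊔q m x)) (expMax-≥-start g-mono ds ds-dist S (m ⊔ x))

  module _ (g-nonNeg : ∀ x → 0ℚ ≤ g x) where

    sumOver-nonNeg : ∀ {n} (ds : Vec Dist n) → Vec.All IsDistribution ds → ∀ S → 0ℚ ≤ sumOver ds S g
    sumOver-nonNeg []       []                 []          = ≤-refl
    sumOver-nonNeg (d ∷ ds) (_ ∷ ds-dist)      (false ∷ S) = sumOver-nonNeg ds ds-dist S
    sumOver-nonNeg (d ∷ ds) (d-dist ∷ ds-dist) (true ∷ S)  =
      +-mono-≤ (expect-≥ d-dist 0ℚ g-nonNeg) (sumOver-nonNeg ds ds-dist S)

    g[p⊔q]≤g[p]+g[q] : ∀ p q → g (p ⊔ q) ≤ g p + g q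
    g[p⊔q]≤g[p]+g[q] p q with ⊔-sel p q
    ... | inj₁ p⊔q≡p rewrite p⊔q≡p =
      subst (_≤ g p + g q) (+-identityʳ (g p)) (+-monoʳ-≤ (g p) (g-nonNeg q))
    ... | inj₂ p⊔q≡q rewrite p⊔q≡q =
      subst (_≤ g p + g q) (+-identityˡ (g q)) (+-monoˡ-≤ (g q) (g-nonNeg p))

    expMax-≤-start+sumOver : ∀ {n} (ds : Vec Dist n) → Vec.All IsDistribution ds →
                             ∀ S m → expMax ds S g m ≤ g m + sumOver ds S g
    expMax-≤-start+sumOver []       []                 []          m = ≤-reflexive (sym (+-identityʳ (g m)))
    expMax-≤-start+sumOver (d ∷ ds) (_ ∷ ds-dist)      (false ∷ S) m = expMax-≤-start+sumOver ds ds-dist S m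
    expMax-≤-start+sumOver (d ∷ ds) (d-dist ∷ ds-dist) (true ∷ S)  m = begin
      expect d (λ x → expMax ds S g (m ⊔ x))  ≤⟨ expect-mono d-dist bound ⟩
      expect d (λ x → (g m + Σ) + g x)       ≡⟨ expect-+ˡ d-dist (g m + Σ) g ⟩
      (g m + Σ) + expect d g                  ≡⟨ solve 3 (λ a s e → (a :+ s) :+ e := a :+ (e :+ s))
                                                         refl (g m) Σ (expect d g) ⟩
      g m + (expect d g + Σ)                  ∎
      where
      open ≤-Reasoning
      Σ = sumOver ds S g
      bound : ∀ x → expMax ds S g (m ⊔ x) ≤ (g m + Σ) + g x
      bound x = begin
        expMax ds S g (m ⊔ x)  ≤⟨ expMax-≤-start+sumOver ds ds-dist S (m ⊔ x) ⟩
        g (m ⊔ x) + Σ          ≤⟨ +-monoˡ-≤ Σ (g[p⊔q]≤g[p]+g[q] m x) ⟩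
        (g m + g x) + Σ        ≡⟨ solve 3 (λ a b s → (a :+ b) :+ s := (a :+ s) :+ b) refl (g m) (g x) Σ ⟩
        (g m + Σ) + g x        ∎

    prodOver-below*sumOver≤expMax :
      Monotonic₁ _≤_ _≤_ g → ∀ {v} → (∀ y → y < v → g y ≡ 0ℚ) →
      ∀ {n} (ds : Vec Dist n) → Vec.All IsDistribution ds →
      ∀ S m → prodOver ds S (below v) * sumOver ds S g ≤ expMax ds S g m
    prodOver-below*sumOver≤expMax g-mono g-vanish []       []                 []          m =
      subst (_≤ g m) (sym (*-zeroʳ 1ℚ)) (g-nonNeg m)
    prodOver-below*sumOver≤expMax g-mono g-vanish (d ∷ ds) (_ ∷ ds-dist)      (false ∷ S) m =
      prodOver-below*sumOver≤expMax g-mono g-vanish ds ds-dist S m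
    prodOver-below*sumOver≤expMax g-mono {v} g-vanish (d ∷ ds) (d-dist ∷ ds-dist) (true ∷ S) m = begin
      (p * P) * (e + Σ)                        ≤⟨ 0≤q-p⇒p≤q (subst (0ℚ ≤_) (sym gap) 0≤e*[1-pP]) ⟩
      e + P * Σ * p                            ≡⟨ sym (trans (expect-+ d g _) (cong (e +_) (expect-*ˡ d (P * Σ) (below v)))) ⟩
      expect d (λ y → g y + P * Σ * below v y) ≤⟨ expect-mono d-dist bound ⟩
      expect d (λ y → expMax ds S g (m ⊔ y))   ∎
      where
      open ≤-Reasoning
      p = expect d (below v)
      P = prodOver ds S (below v)
      Σ = sumOver ds S g
      e = expect d g
      pP≤1 : p * P ≤ 1ℚ
      pP≤1 = prodOver-≤1 (indicator-nonNeg ∘ _) (indicator-≤1 ∘ _) (d ∷ ds) (d-dist ∷ ds-dist) (true ∷ S)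
      0≤e*[1-pP] : 0ℚ ≤ e * (1ℚ - p * P)
      0≤e*[1-pP] = 0≤p⇒0≤q⇒0≤p*q (expect-≥ d-dist 0ℚ g-nonNeg) (p≤q⇒0≤q-p pP≤1)
      gap : (e + P * Σ * p) - (p * P) * (e + Σ) ≡ e * (1ℚ - p * P)
      gap = solve 4 (λ p P e Σ → (e :+ P :* Σ :* p) :- (p :* P) :* (e :+ Σ) := e :* (con 1ℚ :- p :* P))
                    refl p P e Σ
      bound : ∀ y → g y + P * Σ * below v y ≤ expMax ds S g (m ⊔ y)
      bound y with y <? v
      ... | yes y<v rewrite below-< y<v | g-vanish y y<v =
        subst (_≤ expMax ds S g (m ⊔ y)) (solve 1 (λ X → X := con 0ℚ :+ X :* con 1ℚ) refl (P * Σ))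
          (prodOver-below*sumOver≤expMax g-mono g-vanish ds ds-dist S (m ⊔ y))
      ... | no  y≮v rewrite below-≥ {v} (≮⇒≥ y≮v) =
        subst (_≤ expMax ds S g (m ⊔ y)) (solve 2 (λ a X → a := a :+ X :* con 0ℚ) refl (g y) (P * Σ))
          (≤-trans (g-mono (p≤q⊔p m y)) (expMax-≥-start g-mono ds ds-dist S (m ⊔ y)))

expect-minus-excess : ∀ d τ {c} → expect d (λ x → pos (x - τ)) ≡ c →
                      ∀ h → expect d (λ x → h x - pos (x - τ)) ≡ expect d h - c
expect-minus-excess d τ τ-index h = trans (expect-sub d h _) (cong (λ e → expect d h - e) τ-index)

module _ {v τ : ℚ} where

  below-⊓-high : v ≤ τ → ∀ x → below v (x ⊓ τ) ≡ below v x
  below-⊓-high v≤τ x with x <? v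
  ... | yes x<v = trans (below-< (≤-<-trans (p⊓q≤p x τ) x<v)) (sym (below-< x<v))
  ... | no  x≮v = trans (below-≥ (⊓-glb (≮⇒≥ x≮v) v≤τ)) (sym (below-≥ (≮⇒≥ x≮v)))

  expect-below-kappaDist-high : ∀ d → v ≤ τ → expect (kappaDist d τ) (below v) ≡ expect d (below v)
  expect-below-kappaDist-high d v≤τ =
    trans (expect-kappaDist d τ (below v)) (expect-cong d (below-⊓-high v≤τ))

  expect-below-kappaDist-low : ∀ {d} → IsDistribution d → τ < v → expect (kappaDist d τ) (below v) ≡ 1ℚ
  expect-below-kappaDist-low {d} d-dist τ<v = begin
    expect (kappaDist d τ) (below v)   ≡⟨ expect-kappaDist d τ (below v) ⟩
    expect d (λ x → below v (x ⊓ τ))   ≡⟨ expect-cong d (λ x → below-< (≤-<-trans (p⊓q≤q x τ) τ<v)) ⟩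
    expect d (λ _ → 1ℚ)                ≡⟨ expect-const≡ d-dist 1ℚ ⟩
    1ℚ                                 ∎
    where open ≡-Reasoning

Π : {A : Set} → (A → ℚ) → List A → ℚ
Π r []       = 1ℚ
Π r (x ∷ xs) = r x * Π r xs

-- g is arbitrary only for the induction; it is used with g = id, for which List.tabulate g = allFin n.
prodOver-tabulate : ∀ {n} (K : Fin n → Dist) S h {A : Set} (g : Fin n → A) (r : A → ℚ) →
  (∀ i → r (g i) ≡ (if lookup S i then expect (K i) h else 1ℚ)) →
  prodOver (tabulate K) S h ≡ Π r (List.tabulate g)
prodOver-tabulate K []          h g r r∘g≡ = refl
prodOver-tabulate K (false ∷ S) h g r r∘g≡ = begin
  prodOver (tabulate (K ∘ suc)) S h  ≡⟨ prodOver-tabulate (K ∘ suc) S h (g ∘ suc) r (r∘g≡ ∘ suc) ⟩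
  Π r gs                             ≡⟨ sym (*-identityˡ (Π r gs)) ⟩
  1ℚ * Π r gs                        ≡⟨ cong (_* Π r gs) (sym (r∘g≡ zero)) ⟩
  r (g zero) * Π r gs                ∎
  where
  open ≡-Reasoning
  gs = List.tabulate (g ∘ suc)
prodOver-tabulate K (true ∷ S)  h g r r∘g≡ =
  cong₂ _*_ (sym (r∘g≡ zero)) (prodOver-tabulate (K ∘ suc) S h (g ∘ suc) r (r∘g≡ ∘ suc))

module ThresholdPolicy {n} (c : Fin n → ℚ) (D : Fin n → Dist) (τ : Fin n → ℚ) (v : ℚ) (S : Subset n)
  (D-dist : ∀ i → IsDistribution (D i))
  (τ-index : ∀ i → expect (D i) (λ x → pos (x - τ i)) ≡ c i) where

  play : List (Fin n) → ℚ → ℚ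
  play []      m = m
  play (i ∷ L) m with v ≤? m | lookup S i | v ≤? τ i
  ... | yes _ | _    | _     = m
  ... | no  _ | true | yes _ = expect (D i) (λ x → play L (m ⊔ x)) - c i
  ... | no  _ | _    | _     = play L m

  belowProb : Fin n → ℚ
  belowProb i = if lookup S i then expect (kappaDist (D i) (τ i)) (below v) else 1ℚ

  play-stop : ∀ L {m} → v ≤ m → play L m ≡ m
  play-stop []      v≤m = refl
  play-stop (i ∷ L) {m} v≤m with v ≤? m
  ... | yes _   = refl
  ... | no  v≰m = contradiction v≤m v≰m

  play-≤-value : ∀ k U L m → Unique L → All (λ i → lookup U i ≡ true) L → length L ℕ.≤ k →
                 play L m ≤ value c D k U m
  play-≤-value k U []      m _ _ _ = value-≥-stop c D k U m
  play-≤-value k U (i ∷ L) m (i∉L ∷ L!) (U∋i ∷ U⊇L) |iL|≤k with v ≤? m | lookup S i | v ≤? τ i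
  ... | yes _ | _     | _    = value-≥-stop c D k U m
  ... | no  _ | false | _    = play-≤-value k U L m L! U⊇L (ℕ.<⇒≤ |iL|≤k)
  ... | no  _ | true  | no _ = play-≤-value k U L m L! U⊇L (ℕ.<⇒≤ |iL|≤k)
  play-≤-value (ℕ.suc k) U (i ∷ L) m (i∉L ∷ L!) (U∋i ∷ U⊇L) (s≤s |L|≤k) | no _ | true | yes _ =
    ≤-trans (+-monoˡ-≤ (- c i) (expect-mono (D-dist i)
                                  (λ x → play-≤-value k U′ L (m ⊔ x) L! U′⊇L |L|≤k)))
            (value-≥-open c D k U m i U∋i)
    where
    U′ = U [ i ]≔ outside
    U′⊇L : All (λ j → lookup U′ j ≡ true) L
    U′⊇L = All.zipWith (λ (i≢j , U∋j) → trans (lookup∘update′ (i≢j ∘ sym) U outside) U∋j)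
                       (i∉L , U⊇L)

  private
    skip-unit : ∀ {p b} q → p ≡ 1ℚ → v * (1ℚ - q) ≤ b → v * (1ℚ - p * q) ≤ b
    skip-unit {p} {b} q p≡1 =
      subst (λ r → v * (1ℚ - r) ≤ b) (sym (trans (cong (_* q) p≡1) (*-identityˡ q)))

  play-≥ : ∀ L m → 0ℚ ≤ m → m < v → v * (1ℚ - Π belowProb L) ≤ play L m
  play-≥ []      m 0≤m m<v = subst (_≤ m) (sym (trans (cong (v *_) (+-inverseʳ 1ℚ)) (*-zeroʳ v))) 0≤m
  -- Abstracting over lookup S i also specialises the factor belowProb i in the goal.
  play-≥ (i ∷ L) m 0≤m m<v with v ≤? m | lookup S i | v ≤? τ i
  ... | yes v≤m | _     | _       = contradiction v≤m (<⇒≱ m<v)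
  ... | no  _   | false | _       = skip-unit (Π belowProb L) refl (play-≥ L m 0≤m m<v)
  ... | no  _   | true  | no  τ≱v =
    skip-unit (Π belowProb L) (expect-below-kappaDist-low (D-dist i) (≰⇒> τ≱v)) (play-≥ L m 0≤m m<v)
  ... | no  _   | true  | yes v≤τ = begin
    v * (1ℚ - pκ * ΠL)
      ≡⟨ cong (λ q → v * (1ℚ - q * ΠL)) (expect-below-kappaDist-high (D i) v≤τ) ⟩
    v * (1ℚ - p * ΠL)
      ≡⟨ solve 3 (λ v p P → v :* (con 1ℚ :- p :* P) := v :- v :* P :* p) refl v p ΠL ⟩
    v - v * ΠL * p
      ≡⟨ sym (expect-const-minus-below (v * ΠL)) ⟩
    expect (D i) (λ x → v - v * ΠL * below v x)
      ≤⟨ expect-mono (D-dist i) bound ⟩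
    expect (D i) (λ x → play L (m ⊔ x) - pos (x - τ i))
      ≡⟨ expect-minus-excess (D i) (τ i) (τ-index i) (λ x → play L (m ⊔ x)) ⟩
    expect (D i) (λ x → play L (m ⊔ x)) - c i
      ∎
    where
    open ≤-Reasoning
    pκ = expect (kappaDist (D i) (τ i)) (below v)
    p  = expect (D i) (below v)
    ΠL = Π belowProb L
    expect-const-minus-below : ∀ a → expect (D i) (λ x → v - a * below v x) ≡ v - a * p
    expect-const-minus-below a =
      trans (expect-sub (D i) (λ _ → v) _)
            (cong₂ _-_ (expect-const≡ (D-dist i) v) (expect-*ˡ (D i) a (below v)))
    bound : ∀ x → v - v * ΠL * below v x ≤ play L (m ⊔ x) - pos (x - τ i)
    bound x with x <? v
    ... | yes x<v rewrite below-< x<v | p≤q⇒pos[p-q]≡0 (<⇒≤ (<-≤-trans x<v v≤τ)) =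
      subst₂ _≤_ (solve 2 (λ v P → v :* (con 1ℚ :- P) := v :- v :* P :* con 1ℚ) refl v ΠL)
                 (solve 1 (λ b → b := b :- con 0ℚ) refl (play L (m ⊔ x)))
                 (play-≥ L (m ⊔ x) (≤-trans 0≤m (p≤p⊔q m x)) (⊔-lub-< m<v x<v))
    ... | no  x≮v rewrite below-≥ {v} (≮⇒≥ x≮v) | play-stop L (≤-trans (≮⇒≥ x≮v) (p≤q⊔p m x)) =
      begin
      v - v * ΠL * 0ℚ            ≡⟨ solve 2 (λ v P → v :- v :* P :* con 0ℚ := v) refl v ΠL ⟩
      v                          ≤⟨ ⊓-glb (≮⇒≥ x≮v) v≤τ ⟩
      x ⊓ τ i                    ≡⟨ sym (p-pos[p-q]≡p⊓q x (τ i)) ⟩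
      x - pos (x - τ i)          ≤⟨ +-monoˡ-≤ (- pos (x - τ i)) (p≤q⊔p m x) ⟩
      (m ⊔ x) - pos (x - τ i)    ∎

  v*[1-Π]≤OPT : 0ℚ < v → v * (1ℚ - Π belowProb (allFin n)) ≤ OPT c D
  v*[1-Π]≤OPT 0<v = ≤-trans (play-≥ (allFin n) 0ℚ ≤-refl 0<v)
    (play-≤-value n ⊤ (allFin n) 0ℚ (allFin⁺ n) (All.tabulate⁺ lookup-⊤)
                  (ℕ.≤-reflexive (length-tabulate id)))

expect-pos-kappa≤OPT : ∀ {n} (c : Fin n → ℚ) (D : Fin n → Dist) (τ : Fin n → ℚ) →
  (∀ i → IsDistribution (D i)) → (∀ i → expect (D i) (λ x → pos (x - τ i)) ≡ c i) →
  ∀ i → expect (D i) (λ x → pos (x ⊓ τ i)) ≤ OPT c D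
expect-pos-kappa≤OPT {ℕ.suc k} c D τ D-dist τ-index i with ≤-total 0ℚ (τ i)
... | inj₂ τ≤0 =
  ≤-trans (expect-≤ (D-dist i) 0ℚ (λ x → ≤-reflexive (p≥q⇒p⊔q≡p (≤-trans (p⊓q≤q x (τ i)) τ≤0))))
          (value-≥-stop c D (ℕ.suc k) ⊤ 0ℚ)
... | inj₁ 0≤τ = begin
  expect (D i) (λ x → pos (x ⊓ τ i))
    ≡⟨ expect-cong (D i) (λ x → sym (pos[p]-pos[p-q]≡pos[p⊓q] x 0≤τ)) ⟩
  expect (D i) (λ x → pos x - pos (x - τ i))
    ≡⟨ expect-minus-excess (D i) (τ i) (τ-index i) pos ⟩
  expect (D i) pos - c i
    ≤⟨ +-monoˡ-≤ (- c i) (expect-mono (D-dist i) (λ x → value-≥-stop c D k U′ (0ℚ ⊔ x))) ⟩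
  expect (D i) (λ x → value c D k U′ (0ℚ ⊔ x)) - c i
    ≤⟨ value-≥-open c D k ⊤ 0ℚ i (lookup-⊤ i) ⟩
  OPT c D
    ∎
  where
  open ≤-Reasoning
  U′ = ⊤ [ i ]≔ outside

module _ {n} {D : Fin n → Dist} {τ : Fin n → ℚ} (D-dist : ∀ i → IsDistribution (D i)) where

  private
    κ-dist : Vec.All IsDistribution (kappaDists D τ)
    κ-dist = Vec.tabulate⁺ (λ i → kappaDist-isDistribution (τ i) (D-dist i))

    excess-nonNeg : ∀ v y → 0ℚ ≤ pos (y - v)
    excess-nonNeg v y = pos-nonNeg (y - v)

    excess-mono : ∀ v → Monotonic₁ _≤_ _≤_ (λ y → pos (y - v))
    excess-mono v y≤z = pos-mono-≤ (+-monoˡ-≤ (- v) y≤z)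

    excess-vanish : ∀ v y → y < v → pos (y - v) ≡ 0ℚ
    excess-vanish v y y<v = p≤q⇒pos[p-q]≡0 (<⇒≤ y<v)

  F-nonNeg : ∀ S v → 0ℚ ≤ F D τ S v
  F-nonNeg S v = sumOver-nonNeg (excess-nonNeg v) (kappaDists D τ) κ-dist S

  W-nonNeg : ∀ S v → 0ℚ ≤ W D τ S v
  W-nonNeg S v = ≤-trans (excess-nonNeg v 0ℚ) (expMax-≥-start (excess-mono v) (kappaDists D τ) κ-dist S 0ℚ)

  W≤F : ∀ S {v} → 0ℚ ≤ v → W D τ S v ≤ F D τ S v
  W≤F S {v} 0≤v = begin
    W D τ S v                  ≤⟨ expMax-≤-start+sumOver (excess-nonNeg v) (kappaDists D τ) κ-dist S 0ℚ ⟩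
    pos (0ℚ - v) + F D τ S v   ≡⟨ cong (_+ F D τ S v) (p≤q⇒pos[p-q]≡0 0≤v) ⟩
    0ℚ + F D τ S v             ≡⟨ +-identityˡ (F D τ S v) ⟩
    F D τ S v                  ∎
    where open ≤-Reasoning

  P[all-below]*F≤W : ∀ S v → prodOver (kappaDists D τ) S (below v) * F D τ S v ≤ W D τ S v
  P[all-below]*F≤W S v =
    prodOver-below*sumOver≤expMax (excess-nonNeg v) (excess-mono v) (excess-vanish v)
                                  (kappaDists D τ) κ-dist S 0ℚ

  module _ {c : Fin n → ℚ} (τ-index : ∀ i → expect (D i) (λ x → pos (x - τ i)) ≡ c i) where

    v*[1-P[all-below]]≤OPT : ∀ S {v} → 0ℚ < v →
                             v * (1ℚ - prodOver (kappaDists D τ) S (below v)) ≤ OPT c D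
    v*[1-P[all-below]]≤OPT S {v} 0<v = subst (λ P → v * (1ℚ - P) ≤ OPT c D)
      (sym (prodOver-tabulate _ S (below v) id belowProb (λ _ → refl))) (v*[1-Π]≤OPT 0<v)
      where open ThresholdPolicy c D τ v S D-dist τ-index

    F≤0 : ∀ S {v} → 0ℚ ≤ v → OPT c D ≤ 0ℚ → F D τ S v ≤ 0ℚ
    F≤0 S {v} 0≤v OPT≤0 = sumOver-nonPos (kappaDists D τ) (Vec.tabulate⁺ term≤0) S
      where
      term≤0 : ∀ i → expect (kappaDist (D i) (τ i)) (λ y → pos (y - v)) ≤ 0ℚ
      term≤0 i = begin
        expect (kappaDist (D i) (τ i)) (λ y → pos (y - v))  ≡⟨ expect-kappaDist (D i) (τ i) _ ⟩
        expect (D i) (λ x → pos (x ⊓ τ i - v))               ≤⟨ expect-mono (D-dist i) (λ x → pos-mono-≤ (p-q≤p (x ⊓ τ i) 0≤v)) ⟩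
        expect (D i) (λ x → pos (x ⊓ τ i))                   ≤⟨ expect-pos-kappa≤OPT c D τ D-dist τ-index i ⟩
        OPT c D                                              ≤⟨ OPT≤0 ⟩
        0ℚ                                                   ∎
        where open ≤-Reasoning

    [1-ε]F≤W : ∀ S {ε v} → 0ℚ < ε → ε < 1ℚ → 0ℚ ≤ v → OPT c D ≤ ε * v →
               (1ℚ - ε) * F D τ S v ≤ W D τ S v
    [1-ε]F≤W S {ε} {v} 0<ε ε<1 0≤v OPT≤εv with 0ℚ <? v
    ... | yes 0<v = begin
      (1ℚ - ε) * F D τ S v  ≤⟨ *-monoʳ-≤-0≤ (F-nonNeg S v) (p-q≤r⇒p-r≤q {1ℚ} {P} 1-P≤ε) ⟩
      P * F D τ S v         ≤⟨ P[all-below]*F≤W S v ⟩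
      W D τ S v             ∎
      where
      open ≤-Reasoning
      P = prodOver (kappaDists D τ) S (below v)
      1-P≤ε : 1ℚ - P ≤ ε
      1-P≤ε = *-cancelˡ-≤-pos v {{positive 0<v}}
        (≤-trans (v*[1-P[all-below]]≤OPT S 0<v) (subst (OPT c D ≤_) (*-comm ε v) OPT≤εv))
    ... | no  0≮v = begin
      (1ℚ - ε) * F D τ S v  ≤⟨ *-monoˡ-≤-0≤ (p≤q⇒0≤q-p (<⇒≤ ε<1)) (F≤0 S 0≤v OPT≤0) ⟩
      (1ℚ - ε) * 0ℚ         ≡⟨ *-zeroʳ (1ℚ - ε) ⟩
      0ℚ                    ≤⟨ W-nonNeg S v ⟩
      W D τ S v             ∎
      where
      open ≤-Reasoning
      OPT≤0 : OPT c D ≤ 0ℚ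
      OPT≤0 = ≤-trans OPT≤εv (subst (ε * v ≤_) (*-zeroʳ ε) (*-monoˡ-≤-0≤ (<⇒≤ 0<ε) (≮⇒≥ 0≮v)))

lemma9 : (n : ℕ) (c : Fin n → ℚ) (D : Fin n → Dist) (τ : Fin n → ℚ)
    → (∀ i → 0ℚ ≤ c i)
    → (∀ i → All (λ a → 0ℚ ≤ proj₁ a × 0ℚ ≤ proj₂ a) (D i))
    → (∀ i → expect (D i) (λ _ → 1ℚ) ≡ 1ℚ)
    → (∀ i → expect (D i) (λ x → pos (x - τ i)) ≡ c i)
    → (ε θ : ℚ) → 0ℚ < ε → ε < 1ℚ
    → OPT c D ≤ ε * θ → ε * θ ≤ (1ℚ + 1ℚ) * OPT c D
    → (S : Subset n) (v : ℚ) → θ ≤ v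
    → (W D τ S v ≤ F D τ S v) × ((1ℚ - ε) * F D τ S v ≤ W D τ S v)
-- Neither c ≥ 0, nor nonnegativity of the values, nor εθ ≤ 2·OPT is needed.
lemma9 n c D τ _ D-atoms D-mass τ-index ε θ 0<ε ε<1 OPT≤εθ _ S v θ≤v =
  W≤F D-dist S 0≤v , [1-ε]F≤W D-dist τ-index S 0<ε ε<1 0≤v OPT≤εv
  where
  D-dist : ∀ i → IsDistribution (D i)
  D-dist i = record { weights-nonNeg = All.map proj₂ (D-atoms i) ; total-mass = D-mass i }
  OPT≤εv : OPT c D ≤ ε * v
  OPT≤εv = ≤-trans OPT≤εθ (*-monoˡ-≤-0≤ (<⇒≤ 0<ε) θ≤v)
  0≤v : 0ℚ ≤ v
  0≤v = *-cancelˡ-≤-pos ε {{positive 0<ε}}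
          (subst (_≤ ε * v) (sym (*-zeroʳ ε)) (≤-trans (value-≥-stop c D n ⊤ 0ℚ) OPT≤εv))
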